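{- Let $\mathfrak F=(Z_1,Z_\partial,I,R_\Box,R_\Diamond,T)$ be a K-frame. Then for all stable sets $A,C\in\mathcal G(Z_1)$, \[ \blacksquare(A\Rightarrow C)\subseteq \blacksquare A\Rightarrow\blacksquare C . \]
   Context: A frame is a tuple $(Z_1,Z_\partial,I,R_\Box,R_\Diamond,T)$ with $Z_1,Z_\partial$ nonempty, $I\subseteq Z_1\times Z_\partial$, $R_\Box\subseteq Z_\partial\times Z_\partial$, $R_\Diamond\subseteq Z_1\times Z_1$, $T\subseteq Z_\partial\times Z_1\times Z_\partial$. Write $x\nmid y$ iff $(x,y)\notin I$. For $U\subseteq Z_1$, $U'=\{y\in Z_\partial:\forall u\in U\ u\nmid y\}$; for $V\subseteq Z_\partial$, $V'=\{x\in Z_1:\forall v\in V\ x\nmid v\}$. $W$ is a Galois set if $W=W''$; stable sets are Galois subsets of $Z_1$, forming the complete lattice $\mathcal G(Z_1)$ (meet $=\bigcap$, join $\bigvee_i A_i=(\bigcup_iA_i)''$). On each sort $u\preceq w$ iff $\{u\}'\subseteq\{w\}'$; separated means $\preceq$ is a partial order $\le$; $\Gamma u=\{w:u\le w\}$. For a relation $R$ and tuple $\vec u$, $R\vec u=\{w:wR\vec u\}$, Galois dual $R'$: $wR'\vec u$ iff $w\in(R\vec u)'$; $R$ is smooth if every section of $R'$ is a Galois set. Let $xR'_\Box v$ iff $\forall y(yR_\Box v\Rightarrow x\nmid y)$ and $xR''_\Box z$ iff $\forall v(xR'_\Box v\Rightarrow z\nmid v)$ ($x,z\in Z_1$, $v,y\in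 Z_\partial$). Operators on $\mathcal G(Z_1)$: $\blacksquare A=(\{v\in Z_\partial:\exists y\in A'\ vR_\Box y\})'$ and $A\Rightarrow C=(\{v\in Z_\partial:\exists x\in A\,\exists w\in C'\ vTxw\})'$. A refined frame is a frame satisfying: (F1) it is separated; (F2) each of $R_\Box,R_\Diamond,T$ is increasing (for $\le$) in its first argument and decreasing in each other argument; (F3) for every $v\in Z_\partial$, $x\in Z_1$: $R_\Box v$, $R_\Diamond x$ and $Txv$ are each of the form $\Gamma w$ for some point $w$; (F4) $R_\Box,R_\Diamond,T$ are smooth; (F5) for each $x\in Z_1$ the set $S_\Box x=\{z\in Z_1:\forall p\,(zR''_\Box p\Rightarrow p\in\Gamma x)\}$ is of the form $\Gamma w$; (F6) for every stable $A$, $\blacksquare A\subseteq\bigvee_{x\in A}\blacksquare\Gamma x$. Point operators (well defined by F1, F3, F5): for $v\in Z_\partial$, $\boxminus v$ is the point with $R_\Box v=\Gamma(\boxminus v)$; for $x\in Z_1$, $\boxminus x$ is the point with $S_\Box x=\Gamma(\boxminus x)$; for $x\in Z_1,y\in Z_\partial$, $x\rhd y$ is the point with $Txy=\Gamma(x\rhd y)$. A K-frame is a refined frame satisfying (FK): for all $x\in Z_1$ and $y,v,w\in Z_\partial$, if $vT(\boxminus x)(\boxminus y)$ and $w\le x\rhd y$, then $vR_\Box w$. -}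

module Defs where

open import Level using (0ℓ)
open import Data.Product using (Σ; Σ-syntax; ∃; ∃-syntax; _×_; _,_; proj₁)
open import Relation.Nullary using (¬_)
open import Relation.Unary using (Pred; _⊆_)
open import Relation.Binary.PropositionalEquality using (_≡_)
open import Function.Bundles using (_⇔_)

-- A frame (Z₁, Z∂, I, R□, R◇, T); nonemptiness is witnessed by points.
record Frame : Set₁ where
  field
    Z₁ Z∂ : Set
    z₁ : Z₁
    z∂ : Z∂
    I  : Z₁ → Z∂ → Set
    R□ : Z∂ → Z∂ → Set
    R◇ : Z₁ → Z₁ → Set
    T  : Z∂ → Z₁ → Z∂ → Set

module FrameNotions (𝔉 : Frame) where
  open Frame 𝔉

  _∤_ : Z₁ → Z∂ → Set
  x ∤ y = ¬ I x y

  _′₁ : Pred Z₁ 0ℓ → Pred Z∂ 0ℓ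
  (U ′₁) y = ∀ u → U u → u ∤ y

  _′∂ : Pred Z∂ 0ℓ → Pred Z₁ 0ℓ
  (V ′∂) x = ∀ v → V v → x ∤ v

  Galois₁ : Pred Z₁ 0ℓ → Set
  Galois₁ W = (W ⊆ ((W ′₁) ′∂)) × (((W ′₁) ′∂) ⊆ W)

  Galois∂ : Pred Z∂ 0ℓ → Set
  Galois∂ W = (W ⊆ ((W ′∂) ′₁)) × (((W ′∂) ′₁) ⊆ W)

  Stable : Pred Z₁ 0ℓ → Set
  Stable = Galois₁

  -- join in 𝒢(Z₁) of the family (F i) indexed by i with P i
  ⋁ : {J : Set} → Pred J 0ℓ → (J → Pred Z₁ 0ℓ) → Pred Z₁ 0ℓ
  ⋁ P F = ((λ z → ∃[ i ] (P i × F i z)) ′₁) ′∂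

  _⪯₁_ : Z₁ → Z₁ → Set
  u ⪯₁ w = ((λ z → z ≡ u) ′₁) ⊆ ((λ z → z ≡ w) ′₁)

  _⪯∂_ : Z∂ → Z∂ → Set
  u ⪯∂ w = ((λ z → z ≡ u) ′∂) ⊆ ((λ z → z ≡ w) ′∂)

  Γ₁ : Z₁ → Pred Z₁ 0ℓ
  Γ₁ u w = u ⪯₁ w

  Γ∂ : Z∂ → Pred Z∂ 0ℓ
  Γ∂ u w = u ⪯∂ w

  -- separated: ⪯ antisymmetric on each sort (it is always a preorder)
  Separated : Set
  Separated = (∀ u w → u ⪯₁ w → w ⪯₁ u → u ≡ w)
            × (∀ u w → u ⪯∂ w → w ⪯∂ u → u ≡ w)

  R□′ : Z₁ → Z∂ → Set
  R□′ w v = ((λ u → R□ u v) ′∂) w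

  R◇′ : Z∂ → Z₁ → Set
  R◇′ w x = ((λ u → R◇ u x) ′₁) w

  T′ : Z₁ → Z₁ → Z∂ → Set
  T′ w x v = ((λ u → T u x v) ′∂) w

  Smooth□ : Set
  Smooth□ = (∀ v → Galois₁ (λ w → R□′ w v))
          × (∀ w → Galois∂ (λ v → R□′ w v))

  Smooth◇ : Set
  Smooth◇ = (∀ x → Galois∂ (λ w → R◇′ w x))
          × (∀ w → Galois₁ (λ x → R◇′ w x))

  SmoothT : Set
  SmoothT = (∀ x v → Galois₁ (λ w → T′ w x v))
          × (∀ w v → Galois₁ (λ x → T′ w x v))
          × (∀ w x → Galois∂ (λ v → T′ w x v))

  Monotone : Set
  Monotone =
      (∀ u u′ v → u ⪯∂ u′ → R□ u v → R□ u′ v)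
    × (∀ u v v′ → v′ ⪯∂ v → R□ u v → R□ u v′)
    × (∀ u u′ x → u ⪯₁ u′ → R◇ u x → R◇ u′ x)
    × (∀ u x x′ → x′ ⪯₁ x → R◇ u x → R◇ u x′)
    × (∀ u u′ x v → u ⪯∂ u′ → T u x v → T u′ x v)
    × (∀ u x x′ v → x′ ⪯₁ x → T u x v → T u x′ v)
    × (∀ u x v v′ → v′ ⪯∂ v → T u x v → T u x v′)

  R□″ : Z₁ → Z₁ → Set
  R□″ x z = ∀ v → R□′ x v → z ∤ v

  S□ : Z₁ → Pred Z₁ 0ℓ
  S□ x z = ∀ p → R□″ z p → Γ₁ x p

  ■ : Pred Z₁ 0ℓ → Pred Z₁ 0ℓ
  ■ A = (λ v → ∃[ y ] ((A ′₁) y × R□ v y)) ′∂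

  _⇒_ : Pred Z₁ 0ℓ → Pred Z₁ 0ℓ → Pred Z₁ 0ℓ
  A ⇒ C = (λ v → ∃[ x ] ∃[ w ] (A x × (C ′₁) w × T v x w)) ′∂

  infixr 4 _⇒_

record RefinedFrame : Set₁ where
  field
    frame : Frame
  open Frame frame public
  open FrameNotions frame public
  field
    F1 : Separated
    F2 : Monotone
    F3□ : ∀ (v : Z∂) → Σ[ w ∈ Z∂ ] (∀ u → R□ u v ⇔ Γ∂ w u)
    F3◇ : ∀ (x : Z₁) → Σ[ w ∈ Z₁ ] (∀ u → R◇ u x ⇔ Γ₁ w u)
    F3T : ∀ (x : Z₁) (v : Z∂) → Σ[ w ∈ Z∂ ] (∀ u → T u x v ⇔ Γ∂ w u)
    F4□ : Smooth□
    F4◇ : Smooth◇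
    F4T : SmoothT
    F5 : ∀ (x : Z₁) → Σ[ w ∈ Z₁ ] (∀ z → S□ x z ⇔ Γ₁ w z)
    F6 : ∀ (A : Pred Z₁ 0ℓ) → Stable A → ■ A ⊆ ⋁ A (λ x → ■ (Γ₁ x))

  ⊟∂ : Z∂ → Z∂
  ⊟∂ v = proj₁ (F3□ v)

  ⊟₁ : Z₁ → Z₁
  ⊟₁ x = proj₁ (F5 x)

  _▷_ : Z₁ → Z∂ → Z∂
  x ▷ y = proj₁ (F3T x y)

record KFrame : Set₁ where
  field
    refined : RefinedFrame
  open RefinedFrame refined public
  field
    FK : ∀ (x : Z₁) (y v w : Z∂) → T v (⊟₁ x) (⊟∂ y) → w ⪯∂ (x ▷ y) → R□ v w

{-# OPTIONS --safe #-}

-- Fix z ∈ ■ (A ⇒ C); it suffices that z T′ x w for all x ∈ ■ A and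
-- w ∈ (■ C)′. By (FK) this holds for x = ⊟ a and w = ⊟ y with a ∈ A and
-- y ∈ C′, since a ▷ y ∈ (A ⇒ C)′. Monotonicity of T extends it to every
-- x ∈ ■ Γ a ⊆ S□ a = Γ (⊟ a) and to every w with w R□ y, i.e. ⊟ y ≤ w.
-- Smoothness makes the sections of T′ Galois sets, so both extend to the
-- closures: by (F6) ■ A lies in the join of the ■ Γ a, and (■ C)′ is by
-- definition the closure of {w : ∃ y ∈ C′, w R□ y}.

module Submission where

open import Defs
open import Level using (0ℓ)
open import Data.Product using (_,_; proj₁; proj₂)
open import Function.Base using (id; _∘_)
open import Function.Bundles using (Equivalence)
open import Relation.Unary using (Pred; _⊆_)
open import Relation.Binary.PropositionalEquality using (refl)

module GaloisProperties (𝔉 : Frame) where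
  open Frame 𝔉
  open FrameNotions 𝔉

  ′₁-antitone : {U V : Pred Z₁ 0ℓ} → U ⊆ V → (V ′₁) ⊆ (U ′₁)
  ′₁-antitone U⊆V y∈V′ u u∈U = y∈V′ u (U⊆V u∈U)

  ′∂-antitone : {U V : Pred Z∂ 0ℓ} → U ⊆ V → (V ′∂) ⊆ (U ′∂)
  ′∂-antitone U⊆V x∈V′ v v∈U = x∈V′ v (U⊆V v∈U)

  Galois₁-closure-least : {U W : Pred Z₁ 0ℓ} → Galois₁ W → U ⊆ W → ((U ′₁) ′∂) ⊆ W
  Galois₁-closure-least (_ , W″⊆W) U⊆W = W″⊆W ∘ ′∂-antitone (′₁-antitone U⊆W)

  Galois∂-closure-least : {U W : Pred Z∂ 0ℓ} → Galois∂ W → U ⊆ W → ((U ′∂) ′₁) ⊆ W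
  Galois∂-closure-least (_ , W″⊆W) U⊆W = W″⊆W ∘ ′₁-antitone (′∂-antitone U⊆W)

  ■Γ⊆S□ : (a : Z₁) → ■ (Γ₁ a) ⊆ S□ a
  ■Γ⊆S□ a x∈■Γa p xR□″p {y} a∤y .p refl =
    xR□″p y λ u uR□y → x∈■Γa u (y , (λ b a⪯b → a⪯b a∤y b refl) , uR□y)

module RefinedFrameProperties (𝔉 : RefinedFrame) where
  open RefinedFrame 𝔉
  open GaloisProperties frame

  T-antitone₂ : ∀ u x x′ v → x′ ⪯₁ x → T u x v → T u x′ v
  T-antitone₂ = proj₁ (proj₂ (proj₂ (proj₂ (proj₂ (proj₂ F2)))))

  T-antitone₃ : ∀ u x v v′ → v′ ⪯∂ v → T u x v → T u x v′
  T-antitone₃ = proj₂ (proj₂ (proj₂ (proj₂ (proj₂ (proj₂ F2)))))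

  T′-section₁-Galois : ∀ w v → Galois₁ (λ x → T′ w x v)
  T′-section₁-Galois = proj₁ (proj₂ F4T)

  T′-section∂-Galois : ∀ w x → Galois∂ (λ v → T′ w x v)
  T′-section∂-Galois = proj₂ (proj₂ F4T)

  R□⇒⊟⪯ : ∀ {v y} → R□ v y → ⊟∂ y ⪯∂ v
  R□⇒⊟⪯ {v} {y} = Equivalence.to (proj₂ (F3□ y) v)

  ■Γ⇒⊟⪯ : ∀ {a x} → ■ (Γ₁ a) x → ⊟₁ a ⪯₁ x
  ■Γ⇒⊟⪯ {a} {x} = Equivalence.to (proj₂ (F5 a) x) ∘ ■Γ⊆S□ a

  T-▷ : ∀ x y → T (x ▷ y) x y
  T-▷ x y = Equivalence.from (proj₂ (F3T x y) (x ▷ y)) id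

  ▷∈⇒′ : ∀ {A C a y} → A a → (C ′₁) y → ((A ⇒ C) ′₁) (a ▷ y)
  ▷∈⇒′ {a = a} {y} a∈A y∈C′ u u∈A⇒C = u∈A⇒C (a ▷ y) (a , y , a∈A , y∈C′ , T-▷ a y)

module KFrameProperties (𝔉 : KFrame) where
  open KFrame 𝔉
  open GaloisProperties frame
  open RefinedFrameProperties refined

  module _ {A C : Pred Z₁ 0ℓ} {z : Z₁} (z∈■A⇒C : ■ (A ⇒ C) z) where

    T′-⊟ : ∀ {a y} → A a → (C ′₁) y → T′ z (⊟₁ a) (⊟∂ y)
    T′-⊟ {a} {y} a∈A y∈C′ v vT⊟a⊟y =
      z∈■A⇒C v (a ▷ y , ▷∈⇒′ a∈A y∈C′ , FK a y v (a ▷ y) vT⊟a⊟y id)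

    T′-■Γ : ∀ {a x y} → A a → ■ (Γ₁ a) x → (C ′₁) y → T′ z x (⊟∂ y)
    T′-■Γ {a} {x} {y} a∈A x∈■Γa y∈C′ v =
      T′-⊟ a∈A y∈C′ v ∘ T-antitone₂ v x (⊟₁ a) (⊟∂ y) (■Γ⇒⊟⪯ x∈■Γa)

    T′-■ : Stable A → ∀ {x y} → ■ A x → (C ′₁) y → T′ z x (⊟∂ y)
    T′-■ A-stable {y = y} x∈■A y∈C′ =
      Galois₁-closure-least (T′-section₁-Galois z (⊟∂ y))
        (λ (a , a∈A , x∈■Γa) → T′-■Γ a∈A x∈■Γa y∈C′)
        (F6 A A-stable x∈■A)

    T′-■-■′ : Stable A → ∀ {x w} → ■ A x → ((■ C) ′₁) w → T′ z x w
    T′-■-■′ A-stable {x} x∈■A =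
      Galois∂-closure-least (T′-section∂-Galois z x)
        λ {v} (y , y∈C′ , vR□y) u →
          T′-■ A-stable x∈■A y∈C′ u ∘ T-antitone₃ u x v (⊟∂ y) (R□⇒⊟⪯ vR□y)

proposition4p6 : (𝔉 : KFrame) → let open KFrame 𝔉 in
    (A C : Pred Z₁ _) → Stable A → Stable C →
      ■ (A ⇒ C) ⊆ (■ A ⇒ ■ C)
proposition4p6 𝔉 A C A-stable _ z∈■A⇒C v (x , w , x∈■A , w∈■C′ , vTxw) =
  KFrameProperties.T′-■-■′ 𝔉 z∈■A⇒C A-stable x∈■A w∈■C′ v vTxw
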